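{- Let $(G,k)$ be an instance of Tracking Shortest Paths. Then there exists an instance $(G',k)$ of Tracking Paths in DAGs such that $(G,k)$ is a YES instance if and only if $(G',k)$ is a YES instance.
   Context: An $s$-$t$ graph is a graph with a distinguished source $s$ and destination $t$. Tracking Shortest Paths: given an undirected, unweighted $s$-$t$ graph $G$ and integer $k$, decide whether there is $T\subseteq V(G)$ with $|T|\le k$ such that for any two distinct shortest $s$-$t$ paths $P_1,P_2$, $T\cap V(P_1)\ne T\cap V(P_2)$. Tracking Paths in DAGs: given a directed acyclic $s$-$t$ graph $G$ and integer $k$, decide whether there is $T\subseteq V(G)$ with $|T|\le k$ such that for any two distinct directed $s$-$t$ paths $P_1,P_2$ in $G$, $T\cap V(P_1)\ne T\cap V(P_2)$. -}

module Defs where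

open import Data.Nat using (ℕ; _≤_; _≥_)
open import Data.Bool using (Bool; T)
open import Data.Fin using (Fin)
open import Data.Fin.Subset using (Subset; ∣_∣) renaming (_∈_ to _∈ₛ_)
open import Data.List using (List; []; _∷_; length)
open import Data.List.Membership.Propositional using (_∈_)
open import Data.List.Relation.Unary.Unique.Propositional using (Unique)
open import Data.Product using (Σ; _×_)
open import Function.Bundles using (_⇔_)
open import Relation.Binary.PropositionalEquality using (_≡_; _≢_)
open import Relation.Nullary using (¬_)

-- An s-t graph on vertex set Fin n, with a Boolean adjacency relation
-- (for directed graphs: adj u v = true means an arc u → v).
record STGraph : Set where
  field
    n   : ℕ
    adj : Fin n → Fin n → Bool
    s   : Fin n
    t   : Fin n
open STGraph public

Edge : (G : STGraph) → Fin (n G) → Fin (n G) → Set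
Edge G u v = T (adj G u v)

IsUndirected : STGraph → Set
IsUndirected G = (∀ u v → adj G u v ≡ adj G v u) × (∀ v → ¬ Edge G v v)

data Walk (G : STGraph) : Fin (n G) → Fin (n G) → List (Fin (n G)) → Set where
  here : ∀ {v} → Walk G v v (v ∷ [])
  step : ∀ {u w v P} → Edge G u w → Walk G w v P → Walk G u v (u ∷ P)

Path : (G : STGraph) → Fin (n G) → Fin (n G) → List (Fin (n G)) → Set
Path G u v P = Walk G u v P × Unique P

-- Directed acyclic: no closed walk with at least one edge.
IsDAG : STGraph → Set
IsDAG G = ∀ v P → Walk G v v P → ¬ (length P ≥ 2)

STPath : (G : STGraph) → List (Fin (n G)) → Set
STPath G P = Path G (s G) (t G) P

ShortestSTPath : (G : STGraph) → List (Fin (n G)) → Set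
ShortestSTPath G P = STPath G P × (∀ Q → STPath G Q → length P ≤ length Q)

SameTrace : (G : STGraph) → Subset (n G) → List (Fin (n G)) → List (Fin (n G)) → Set
SameTrace G X P₁ P₂ = ∀ v → ((v ∈ₛ X) × (v ∈ P₁)) ⇔ ((v ∈ₛ X) × (v ∈ P₂))

Tracks : (G : STGraph) → (List (Fin (n G)) → Set) → Subset (n G) → Set
Tracks G Fam X = ∀ P₁ P₂ → Fam P₁ → Fam P₂ → P₁ ≢ P₂ → ¬ SameTrace G X P₁ P₂

TSP-YES : STGraph → ℕ → Set
TSP-YES G k = Σ (Subset (n G)) λ X → (∣ X ∣ ≤ k) × Tracks G (ShortestSTPath G) X

TPD-YES : STGraph → ℕ → Set
TPD-YES G k = Σ (Subset (n G)) λ X → (∣ X ∣ ≤ k) × Tracks G (STPath G) X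

-- Let D be the distance from s to t.  Orient every edge uv of G that lies on a
-- shortest s-t walk, i.e. with d(s,u) + 1 + d(v,t) = D, as an arc u → v.  Along
-- an arc the distance from s grows by exactly one, so the resulting graph is
-- acyclic, and its s-t paths are precisely the shortest s-t paths of G, as
-- vertex lists.  Both instances therefore have the same tracking sets.  If t is
-- unreachable, D is replaced by n: then both path families are empty.
module Submission where

open import Defs
open import Data.Nat using (ℕ; zero; suc; _+_; _∸_; _≤_; _<_; _≤?_; z≤n; s≤s)
import Data.Nat as ℕ
open import Data.Nat.Properties
  using ( ≤-refl; ≤-reflexive; ≤-trans; ≤-antisym; <⇒≤; ≰⇒>; ≮⇒≥; m∸n≤m; ∸-monoˡ-≤
        ; m≤n+m; m<m+n; m+n≤o⇒m≤o; m+n≤o⇒n≤o; +-suc; +-identityʳ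
        ; +-cancelʳ-≤; m≢1+m+n; m≤n⇒m≤1+n; m<1+n⇒m<n∨m≡n)
open import Data.Bool.Properties using (T?)
open import Data.Fin using (Fin; toℕ; fromℕ<; _≟_)
open import Data.Fin.Properties using (any?; pigeonhole; toℕ-fromℕ<; <⇒≢)
open import Data.Fin.Subset using (Subset; ∣_∣)
open import Data.List using (List; []; _∷_; length; lookup)
open import Data.List.Membership.Propositional using (_∈_)
open import Data.List.Membership.Propositional.Properties using (∈-lookup)
import Data.List.Membership.DecPropositional as DecMembership
open import Data.List.Relation.Unary.Any using (here; there)
import Data.List.Relation.Unary.All as All
open import Data.List.Relation.Unary.All.Properties using (¬Any⇒All¬)
open import Data.List.Relation.Unary.AllPairs using ([]; _∷_)
open import Data.List.Relation.Unary.Unique.Propositional using (Unique)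
open import Data.Product using (Σ; ∃; ∃₂; _×_; _,_; proj₁; map₂)
open import Data.Sum using (_⊎_; inj₁; inj₂)
open import Data.Empty using (⊥-elim)
open import Function.Base using (_∘_)
open import Function.Bundles using (_⇔_; mk⇔; Equivalence)
open import Relation.Binary.PropositionalEquality using (_≡_; refl; sym; trans; cong; subst; subst₂)
open import Relation.Nullary using (¬_; Dec; yes; no)
open import Relation.Nullary.Decidable using (⌊_⌋; toWitness; fromWitness; map′; _×-dec_)

Unique⇒lookup-injective : ∀ {A : Set} {xs : List A} → Unique xs →
                          ∀ i j → lookup xs i ≡ lookup xs j → i ≡ j
Unique⇒lookup-injective (_  ∷ _)   Fin.zero    Fin.zero    _  = refl
Unique⇒lookup-injective (x∉ ∷ _)   Fin.zero    (Fin.suc j) eq = ⊥-elim (All.lookup x∉ (∈-lookup j) eq)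
Unique⇒lookup-injective (x∉ ∷ _)   (Fin.suc i) Fin.zero    eq = ⊥-elim (All.lookup x∉ (∈-lookup i) (sym eq))
Unique⇒lookup-injective (_  ∷ xs!) (Fin.suc i) (Fin.suc j) eq = cong Fin.suc (Unique⇒lookup-injective xs! i j eq)

Unique⇒length≤ : ∀ {m} (xs : List (Fin m)) → Unique xs → length xs ≤ m
Unique⇒length≤ {m} xs xs! with length xs ≤? m
... | yes ≤m = ≤m
... | no ≰m with pigeonhole (≰⇒> ≰m) (lookup xs)
...   | i , j , i<j , eq = ⊥-elim (<⇒≢ i<j (Unique⇒lookup-injective xs! i j eq))

hops : ∀ {A : Set} → List A → ℕ
hops P = length P ∸ 1

walk-length : ∀ {G u v P} → Walk G u v P → length P ≡ suc (hops P)
walk-length here       = refl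
walk-length (step _ _) = refl

Tracks-antitone : ∀ G {X} {F₁ F₂ : List (Fin (n G)) → Set} →
                  (∀ {P} → F₂ P → F₁ P) → Tracks G F₁ X → Tracks G F₂ X
Tracks-antitone _ F₂⊆F₁ tracks P₁ P₂ p₁ p₂ = tracks P₁ P₂ (F₂⊆F₁ p₁) (F₂⊆F₁ p₂)

tracking-instances-equivalent :
  ∀ G {k} {F₁ F₂ : List (Fin (n G)) → Set} → (∀ {P} → F₁ P ⇔ F₂ P) →
  (Σ (Subset (n G)) λ X → ∣ X ∣ ≤ k × Tracks G F₁ X) ⇔
  (Σ (Subset (n G)) λ X → ∣ X ∣ ≤ k × Tracks G F₂ X)
tracking-instances-equivalent G F₁⇔F₂ = mk⇔
  (map₂ (map₂ (Tracks-antitone G (Equivalence.from F₁⇔F₂))))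
  (map₂ (map₂ (Tracks-antitone G (Equivalence.to F₁⇔F₂))))

module _ (G : STGraph) where

  private
    V : Set
    V = Fin (n G)
    open DecMembership (_≟_ {n G}) using (_∈?_)

  infixr 5 _∷_
  infixl 5 _∷ʳ_
  infixr 5 _++_
  infix  4 _⟶[_]_

  data _⟶[_]_ : V → ℕ → V → Set where
    []  : ∀ {u} → u ⟶[ 0 ] u
    _∷_ : ∀ {u w v m} → Edge G u w → w ⟶[ m ] v → u ⟶[ suc m ] v

  _++_ : ∀ {u v w a b} → u ⟶[ a ] v → v ⟶[ b ] w → u ⟶[ a + b ] w
  []      ++ r′ = r′
  (e ∷ r) ++ r′ = e ∷ (r ++ r′)

  _∷ʳ_ : ∀ {u v w m} → u ⟶[ m ] v → Edge G v w → u ⟶[ suc m ] w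
  []       ∷ʳ e = e ∷ []
  (e′ ∷ r) ∷ʳ e = e′ ∷ (r ∷ʳ e)

  reach? : ∀ m u v → Dec (u ⟶[ m ] v)
  reach? zero u v with u ≟ v
  ... | yes refl = yes []
  ... | no u≢v   = no λ { [] → u≢v refl }
  reach? (suc m) u v =
    map′ (λ { (_ , e , r) → e ∷ r }) (λ { (e ∷ r) → _ , e , r })
         (any? λ w → T? (adj G u w) ×-dec reach? m w v)

  walk⇒reach : ∀ {u v P} → Walk G u v P → u ⟶[ hops P ] v
  walk⇒reach here       = []
  walk⇒reach (step e W) = subst (_ ⟶[_] _) (sym (walk-length W)) (e ∷ walk⇒reach W)

  path-hops<n : ∀ {u v P} → Path G u v P → hops P < n G
  path-hops<n {P = P} (W , P!) = subst (_≤ n G) (walk-length W) (Unique⇒length≤ P P!)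

  suffix-path : ∀ {u w v Q} → u ∈ Q → Path G w v Q → ∃ λ Q′ → Path G u v Q′ × hops Q′ ≤ hops Q
  suffix-path (here refl)  p@(here , _)     = _ , p , ≤-refl
  suffix-path (here refl)  p@(step _ _ , _) = _ , p , ≤-refl
  suffix-path (there ())   (here , _)
  suffix-path (there u∈Q) (step _ W , _ ∷ Q!) with suffix-path u∈Q (W , Q!)
  ... | Q′ , p , Q′≤Q = Q′ , p , ≤-trans Q′≤Q (m∸n≤m _ 1)

  reach⇒path : ∀ {u v m} → u ⟶[ m ] v → ∃ λ Q → Path G u v Q × hops Q ≤ m
  reach⇒path []            = _ , (here , All.[] ∷ []) , z≤n
  reach⇒path {u} (e ∷ r) with reach⇒path r
  ... | Q , (W , Q!) , Q≤m with u ∈? Q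
  ...   | yes u∈Q = let Q′ , p , Q′≤Q = suffix-path u∈Q (W , Q!)
                    in Q′ , p , m≤n⇒m≤1+n (≤-trans Q′≤Q Q≤m)
  ...   | no u∉Q  = u ∷ Q , (step e W , ¬Any⇒All¬ Q u∉Q ∷ Q!) ,
                    ≤-trans (≤-reflexive (walk-length W)) (s≤s Q≤m)

  -- D = min (d(s,t), c)
  capped-distance : ∀ c → ∃ λ D → (∀ m → m < D → ¬ s G ⟶[ m ] t G) × (s G ⟶[ D ] t G ⊎ D ≡ c)
  capped-distance zero = 0 , (λ _ ()) , inj₂ refl
  capped-distance (suc c) with capped-distance c
  ... | D , below , inj₁ r = D , below , inj₁ r
  ... | _ , below , inj₂ refl with reach? c (s G) (t G)
  ...   | yes r  = c , below , inj₁ r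
  ...   | no ¬r  = suc c , below′ , inj₂ refl
    where
    below′ : ∀ m → m < suc c → ¬ s G ⟶[ m ] t G
    below′ m m<1+c with m<1+n⇒m<n∨m≡n m<1+c
    ... | inj₁ m<c  = below m m<c
    ... | inj₂ refl = ¬r

  shortest-hops≤ : ∀ {D P} → s G ⟶[ D ] t G ⊎ D ≡ n G → ShortestSTPath G P → hops P ≤ D
  shortest-hops≤ (inj₁ r) (_ , minimal) with reach⇒path r
  ... | Q , q , Q≤D = ≤-trans (∸-monoˡ-≤ 1 (minimal Q q)) Q≤D
  shortest-hops≤ (inj₂ refl) (p , _) = <⇒≤ (path-hops<n p)

  module ShortestPathDAG (D : ℕ) (below : ∀ m → m < D → ¬ s G ⟶[ m ] t G) where

    D≤ : ∀ {m} → s G ⟶[ m ] t G → D ≤ m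
    D≤ {m} r = ≮⇒≥ λ m<D → below m m<D r

    OnShortestWalk : V → ℕ → ℕ → Set
    OnShortestWalk u a b = s G ⟶[ a ] u × u ⟶[ b ] t G × a + b ≡ D

    ShortestArc : V → V → Set
    ShortestArc u v = Edge G u v × Σ (Fin D) λ a → Σ (Fin D) λ b →
      toℕ a + suc (toℕ b) ≡ D × s G ⟶[ toℕ a ] u × v ⟶[ toℕ b ] t G

    shortestArc? : ∀ u v → Dec (ShortestArc u v)
    shortestArc? u v = T? (adj G u v) ×-dec any? λ a → any? λ b →
      (toℕ a + suc (toℕ b) ℕ.≟ D) ×-dec reach? _ (s G) u ×-dec reach? _ v (t G)

    dag : STGraph
    dag = record { n = n G ; adj = λ u v → ⌊ shortestArc? u v ⌋ ; s = s G ; t = t G }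

    position-unique : ∀ {u a b a′ b′} → OnShortestWalk u a b → OnShortestWalk u a′ b′ → a ≡ a′
    position-unique {u} (sa , bt , a+b≡D) (sa′ , b′t , a′+b′≡D) =
      ≤-antisym (prefix≤ sa′ bt a+b≡D) (prefix≤ sa b′t a′+b′≡D)
      where
      prefix≤ : ∀ {x x′ y′} → s G ⟶[ x ] u → u ⟶[ y′ ] t G → x′ + y′ ≡ D → x′ ≤ x
      prefix≤ {x} {x′} {y′} sx y′t eq =
        +-cancelʳ-≤ y′ x′ x (subst (_≤ x + y′) (sym eq) (D≤ (sx ++ y′t)))

    arc-positions : ∀ {u v} → Edge dag u v →
                    ∃₂ λ a b → OnShortestWalk u a (suc b) × OnShortestWalk v (suc a) b
    arc-positions {u} {v} arc with toWitness {a? = shortestArc? u v} arc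
    ... | e , a , b , eq , sa , bt =
      toℕ a , toℕ b , (sa , e ∷ bt , eq) , (sa ∷ʳ e , bt , trans (sym (+-suc (toℕ a) (toℕ b))) eq)

    edge⇒arc : ∀ {u v a b} → Edge G u v → s G ⟶[ a ] u → v ⟶[ b ] t G → a + suc b ≡ D → Edge dag u v
    edge⇒arc {u} {v} {a} {b} e sa bt eq
      with fromℕ< a<D | toℕ-fromℕ< a<D | fromℕ< b<D | toℕ-fromℕ< b<D
      where
      a<D : a < D
      a<D = subst (a <_) eq (m<m+n a (s≤s z≤n))
      b<D : b < D
      b<D = subst (b <_) eq (m≤n+m (suc b) a)
    ... | a′ | refl | b′ | refl = fromWitness {a? = shortestArc? u v} (e , a′ , b′ , eq , sa , bt)

    arc⇒edge : ∀ {u v} → Edge dag u v → Edge G u v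
    arc⇒edge {u} {v} = proj₁ ∘ toWitness {a? = shortestArc? u v}

    dag-walk⇒walk : ∀ {u v P} → Walk dag u v P → Walk G u v P
    dag-walk⇒walk here         = here
    dag-walk⇒walk (step arc W) = step (arc⇒edge arc) (dag-walk⇒walk W)

    dag-walk-ascends : ∀ {u v P a b} → OnShortestWalk u a b → Walk dag u v P →
                       ∃ λ b′ → OnShortestWalk v (a + hops P) b′
    dag-walk-ascends {a = a} {b} pu here = b , subst (λ x → OnShortestWalk _ x b) (sym (+-identityʳ a)) pu
    dag-walk-ascends {v = v} pu (step arc W) with arc-positions arc
    ... | a₀ , _ , pu′ , pw with position-unique pu pu′
    ... | refl with dag-walk-ascends pw W
    ... | b′ , pv = b′ , subst (λ x → OnShortestWalk v x b′)
                              (trans (sym (+-suc a₀ _)) (cong (a₀ +_) (sym (walk-length W)))) pv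

    dag-acyclic : IsDAG dag
    dag-acyclic _ _ here (s≤s ())
    dag-acyclic _ _ (step arc W) _ with arc-positions arc
    ... | a , _ , pv , pw with dag-walk-ascends pw W
    ... | _ , pv′ = m≢1+m+n a (position-unique pv pv′)

    dag-walk-hops≤ : ∀ {u v P} → Walk dag u v P → hops P ≤ D
    dag-walk-hops≤ here = z≤n
    dag-walk-hops≤ {P = P} W@(step arc _) with arc-positions arc
    ... | a , _ , pu , _ with dag-walk-ascends pu W
    ... | _ , (_ , _ , eq) = m+n≤o⇒n≤o a (m+n≤o⇒m≤o (a + hops P) (≤-reflexive eq))

    dag-path⇒shortest : ∀ {P} → STPath dag P → ShortestSTPath G P
    dag-path⇒shortest (W , P!) = (dag-walk⇒walk W , P!) , λ Q (WQ , _) →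
      subst₂ _≤_ (sym (walk-length W)) (sym (walk-length WQ))
             (s≤s (≤-trans (dag-walk-hops≤ W) (D≤ (walk⇒reach WQ))))

    walk⇒dag-walk : ∀ {u Q i} → s G ⟶[ i ] u → Walk G u (t G) Q → i + hops Q ≡ D → Walk dag u (t G) Q
    walk⇒dag-walk _ here _ = here
    walk⇒dag-walk {i = i} si (step {P = Q} e W) eq =
      step (edge⇒arc e si (walk⇒reach W) i+1+Q≡D)
           (walk⇒dag-walk (si ∷ʳ e) W (trans (sym (+-suc i (hops Q))) i+1+Q≡D))
      where
      i+1+Q≡D : i + suc (hops Q) ≡ D
      i+1+Q≡D = trans (cong (i +_) (sym (walk-length W))) eq

    path⇒dag-path : ∀ {P} → STPath G P → hops P ≤ D → STPath dag P
    path⇒dag-path (W , P!) P≤D = walk⇒dag-walk [] W (≤-antisym P≤D (D≤ (walk⇒reach W))) , P!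

lemma10 : (G : STGraph) → IsUndirected G → (k : ℕ) →
    Σ STGraph (λ G' → IsDAG G' × (TSP-YES G k ⇔ TPD-YES G' k))
lemma10 G _ k with capped-distance G (n G)
... | D , below , reached = dag , dag-acyclic , tracking-instances-equivalent G shortest⇔dag-path
  where
  open ShortestPathDAG G D below

  shortest⇔dag-path : ∀ {P} → ShortestSTPath G P ⇔ STPath dag P
  shortest⇔dag-path = mk⇔ (λ sp → path⇒dag-path (proj₁ sp) (shortest-hops≤ G reached sp)) dag-path⇒shortest
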